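{- Let $n \geq m \geq 2$ and let $K_{n,m}$ be the complete bipartite graph with bipartition $(X,Y)$, where $|X|=n$ and $|Y|=m$. Let $U$ be a strong edge geodetic set of $K_{n,m}$. If $n$ is odd and $X \subseteq U$, then $|U| \geq \frac{2n}{n+1} + m$.
   Context: All graphs are finite and simple. For a graph $G$, a set $S\subseteq V(G)$ is a strong edge geodetic set if to each (unordered) pair of vertices $u,v\in S$ one can assign one shortest $u,v$-path (or no path) such that every edge of $G$ lies on at least one of the assigned paths. -}

module Defs where

open import Data.Nat using (ℕ; zero; suc; _+_; _<_; _≤_)
open import Data.Fin using (Fin; toℕ)
open import Data.Fin.Subset using (Subset; _∈_)
open import Data.List using (List; []; _∷_)
open import Data.List.Relation.Unary.Unique.Propositional using (Unique)
open import Data.Maybe using (Maybe; just)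
open import Data.Product using (Σ; _×_; _,_; ∃)
open import Data.Sum using (_⊎_)
open import Data.Empty using (⊥)
open import Relation.Binary.PropositionalEquality using (_≡_)
open import Relation.Nullary using (¬_)

record Graph (N : ℕ) : Set₁ where
  field
    Adj   : Fin N → Fin N → Set
    sym   : ∀ {u v} → Adj u v → Adj v u
    irrefl : ∀ {u} → ¬ Adj u u
open Graph public

data Walk {N : ℕ} (G : Graph N) : Fin N → Fin N → Set where
  stop : (v : Fin N) → Walk G v v
  step : {u w v : Fin N} → Adj G u w → Walk G w v → Walk G u v

len : ∀ {N} {G : Graph N} {u v} → Walk G u v → ℕ
len (stop _)   = 0
len (step _ W) = suc (len W)

verts : ∀ {N} {G : Graph N} {u v} → Walk G u v → List (Fin N)
verts (stop v) = v ∷ []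
verts (step {u = u} _ W) = u ∷ verts W

IsPath : ∀ {N} {G : Graph N} {u v} → Walk G u v → Set
IsPath W = Unique (verts W)

IsShortestPath : ∀ {N} {G : Graph N} {u v} → Walk G u v → Set
IsShortestPath {G = G} {u} {v} P =
  IsPath P × (∀ (Q : Walk G u v) → IsPath Q → len P ≤ len Q)

ShortestPath : ∀ {N} (G : Graph N) → Fin N → Fin N → Set
ShortestPath G u v = Σ (Walk G u v) IsShortestPath

data EdgeOn {N : ℕ} {G : Graph N} (a b : Fin N) : ∀ {u v} → Walk G u v → Set where
  here  : ∀ {u w v} (e : Adj G u w) (W : Walk G w v) →
          ((a ≡ u × b ≡ w) ⊎ (a ≡ w × b ≡ u)) → EdgeOn a b (step e W)
  there : ∀ {u w v} (e : Adj G u w) (W : Walk G w v) →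
          EdgeOn a b W → EdgeOn a b (step e W)

-- S is a strong edge geodetic set: to each unordered pair {u,v} ⊆ S
-- (represented by u < v) one assigns one shortest u,v-path or no path,
-- such that every edge of G lies on some assigned path.
StrongEdgeGeodetic : ∀ {N} (G : Graph N) → Subset N → Set
StrongEdgeGeodetic {N} G S =
  Σ ((u v : Fin N) → u ∈ S → v ∈ S → toℕ u < toℕ v → Maybe (ShortestPath G u v))
    λ assign → ∀ (a b : Fin N) → Adj G a b →
      Σ (Fin N) λ u → Σ (Fin N) λ v → Σ (u ∈ S) λ hu → Σ (v ∈ S) λ hv →
      Σ (toℕ u < toℕ v) λ lt → Σ (ShortestPath G u v) λ P →
        (assign u v hu hv lt ≡ just P) × EdgeOn a b (Σ.proj₁ P)

InX : (n : ℕ) {k : ℕ} → Fin k → Set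
InX n i = toℕ i < n

-- the complete bipartite graph K_{n,m} with X = {0..n-1}, Y = {n..n+m-1}
KAdj : (n m : ℕ) → Fin (n + m) → Fin (n + m) → Set
KAdj n m i j = (toℕ i < n × n ≤ toℕ j) ⊎ (n ≤ toℕ i × toℕ j < n)

K : (n m : ℕ) → Graph (n + m)
K n m = record { Adj = KAdj n m ; sym = s ; irrefl = irr }
  where
  open import Data.Sum using (inj₁; inj₂)
  open import Data.Nat.Properties using (<⇒≱)
  s : ∀ {u v} → KAdj n m u v → KAdj n m v u
  s (inj₁ (p , q)) = inj₂ (q , p)
  s (inj₂ (p , q)) = inj₁ (q , p)
  irr : ∀ {u} → ¬ KAdj n m u u
  irr (inj₁ (p , q)) = <⇒≱ p q
  irr (inj₂ (p , q)) = <⇒≱ q p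

-- Let Y′ be the set of vertices of Y outside U. An edge x y with y ∈ Y′ must lie on the
-- geodesic assigned to some pair of vertices of U; geodesics of K_{n,m} have length at most 2,
-- so that geodesic is x′ y x″ with x′, x″ ∈ X and x ∈ {x′, x″}. Label every pair of
-- X-vertices by the middle vertex of its assigned geodesic. For y ∈ Y′ the pairs labelled y
-- cover all of X, so since n is odd there are at least (n + 1)/2 of them. Pairs carry one
-- label each, hence |Y′|(n + 1)/2 ≤ n(n − 1)/2, i.e. |Y′| ≤ n − 2, and |U| ≥ m + 2.
module Submission where

open import Defs hiding (sym)

open import Data.Bool using (true; false)
open import Data.Fin using (Fin; zero; suc; toℕ; fromℕ<; _↑ˡ_; _↑ʳ_) renaming (_<_ to _<ᶠ_)
open import Data.Fin.Properties
  using (toℕ-↑ˡ; toℕ-↑ʳ; toℕ<n; toℕ-injective; toℕ-fromℕ<; ↑ˡ-injective)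
  renaming (_<?_ to _<?ᶠ_)
import Data.Fin.Properties as Finₚ
open import Data.Fin.Subset using (Subset; _∈_; _∉_; ∣_∣; ∁)
open import Data.Fin.Subset.Properties using (∣∁p∣≡n∸∣p∣; x∈∁p⇒x∉p)
open import Data.List using (List; []; _∷_; length; filter; map; allFin; _++_)
open import Data.List.Properties using (length-++; length-map; length-tabulate)
open import Data.List.Membership.Propositional using () renaming (_∈_ to _∈ₗ_)
open import Data.List.Membership.Propositional.Properties
  using (∈-∃++; ∈-++⁻; ∈-++⁺ˡ; ∈-++⁺ʳ; ∈-filter⁺; ∈-map⁺; ∈-map⁻; ∈-allFin)
open import Data.List.Relation.Binary.Subset.Propositional using (_⊆_)
open import Data.List.Relation.Unary.All as All using ([]; _∷_)
open import Data.List.Relation.Unary.AllPairs using ([]; _∷_)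
open import Data.List.Relation.Unary.Any using (here; there)
open import Data.List.Relation.Unary.Unique.Propositional using (Unique)
open import Data.List.Relation.Unary.Unique.Propositional.Properties using (allFin⁺; map⁺)
open import Data.Maybe using (Maybe; just; nothing)
open import Data.Nat
open import Data.Nat.DivMod using (m*n%n≡0)
open import Data.Nat.Properties
open import Data.Nat.Tactic.RingSolver using (solve-∀)
open import Data.Product as Product using (Σ; _×_; _,_; ∃; proj₁; proj₂)
open import Data.Sum as Sum using (_⊎_; inj₁; inj₂)
open import Data.Vec.Base using ([]; _∷_; here; there)
open import Data.Vec.Properties.WithK using ([]=-irrelevant)
open import Function using (_∘_)
open import Relation.Binary.Definitions using (DecidableEquality)
open import Relation.Binary.PropositionalEquality
open import Relation.Nullary using (yes; no; ¬?; contradiction)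
open import Relation.Unary using (Decidable)

unique-⊆⇒length≤ : ∀ {A : Set} {xs ys : List A} → Unique xs → xs ⊆ ys → length xs ≤ length ys
unique-⊆⇒length≤ [] _ = z≤n
unique-⊆⇒length≤ {xs = x ∷ xs} (x∉xs ∷ uxs) xs⊆ys with ∈-∃++ (xs⊆ys (here refl))
... | as , bs , refl = begin
  suc (length xs)              ≤⟨ s≤s (unique-⊆⇒length≤ uxs xs⊆as++bs) ⟩
  suc (length (as ++ bs))      ≡⟨ cong suc (length-++ as) ⟩
  suc (length as + length bs)  ≡⟨ sym (+-suc (length as) (length bs)) ⟩
  length as + length (x ∷ bs)  ≡⟨ sym (length-++ as) ⟩
  length (as ++ x ∷ bs)        ∎
  where
  open ≤-Reasoning
  xs⊆as++bs : xs ⊆ as ++ bs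
  xs⊆as++bs z∈xs with ∈-++⁻ as (xs⊆ys (there z∈xs))
  ... | inj₁ z∈as         = ∈-++⁺ˡ z∈as
  ... | inj₂ (here refl)  = contradiction refl (All.lookup x∉xs z∈xs)
  ... | inj₂ (there z∈bs) = ∈-++⁺ʳ as z∈bs

module _ {A : Set} {P : A → Set} (P? : Decidable P) where

  length-filter+length-filter-¬ : ∀ xs →
    length (filter P? xs) + length (filter (¬? ∘ P?) xs) ≡ length xs
  length-filter+length-filter-¬ [] = refl
  length-filter+length-filter-¬ (x ∷ xs) with P? x
  ... | yes _ = cong suc (length-filter+length-filter-¬ xs)
  ... | no _  = trans (+-suc _ _) (cong suc (length-filter+length-filter-¬ xs))

module _ {A B : Set} (_≟_ : DecidableEquality B) (f : A → B) where

  ContainsFibre : B → List A → List A → Set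
  ContainsFibre y xs zs = ∀ {x} → x ∈ₗ xs → f x ≡ y → x ∈ₗ zs

  -- The hypothesis speaks of every list containing a fibre, not of the fibre itself, so that
  -- it survives filtering out the other fibres in the induction.
  fibres-length : ∀ {k c} xs {ys} → Unique ys →
    (∀ {y} → y ∈ₗ ys → ∀ zs → ContainsFibre y xs zs → k ≤ c * length zs) →
    length ys * k ≤ c * length xs
  fibres-length xs [] _ = z≤n
  fibres-length {k} {c} xs {y ∷ ys} (y∉ys ∷ uys) large = begin
    k + length ys * k                   ≤⟨ +-mono-≤ (large (here refl) fibre (∈-filter⁺ isY))
                                                     (fibres-length {k} {c} rest uys large-rest) ⟩
    c * length fibre + c * length rest  ≡⟨ sym (*-distribˡ-+ c (length fibre) (length rest)) ⟩
    c * (length fibre + length rest)    ≡⟨ cong (c *_) (length-filter+length-filter-¬ isY xs) ⟩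
    c * length xs                       ∎
    where
    open ≤-Reasoning
    isY : Decidable (λ x → f x ≡ y)
    isY x = f x ≟ y
    fibre rest : List A
    fibre = filter isY xs
    rest = filter (¬? ∘ isY) xs
    large-rest : ∀ {y′} → y′ ∈ₗ ys → ∀ zs → ContainsFibre y′ rest zs → k ≤ c * length zs
    large-rest y′∈ys zs rest⊆zs = large (there y′∈ys) zs λ x∈xs fx≡y′ →
      rest⊆zs (∈-filter⁺ (¬? ∘ isY) x∈xs λ fx≡y → All.lookup y∉ys y′∈ys (trans (sym fx≡y) fx≡y′))
              fx≡y′

module _ {A : Set} where

  Endpoint : A → A × A → Set
  Endpoint x (a , b) = x ≡ a ⊎ x ≡ b

  endpoints : List (A × A) → List A
  endpoints [] = []
  endpoints ((a , b) ∷ ps) = a ∷ b ∷ endpoints ps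

  length-endpoints : ∀ ps → length (endpoints ps) ≡ 2 * length ps
  length-endpoints [] = refl
  length-endpoints (_ ∷ ps) =
    cong suc (trans (cong suc (length-endpoints ps)) (sym (+-suc (length ps) (1 * length ps))))

  ∈-endpoints⁺ : ∀ {x p ps} → p ∈ₗ ps → Endpoint x p → x ∈ₗ endpoints ps
  ∈-endpoints⁺ (here refl) (inj₁ refl) = here refl
  ∈-endpoints⁺ (here refl) (inj₂ refl) = there (here refl)
  ∈-endpoints⁺ {p = _ , _} (there p∈ps) x∈p = there (there (∈-endpoints⁺ p∈ps x∈p))

pairs-cover⇒≤2*length : ∀ {n} (ps : List (Fin n × Fin n)) →
  (∀ x → ∃ λ p → p ∈ₗ ps × Endpoint x p) → n ≤ 2 * length ps
pairs-cover⇒≤2*length {n} ps cover = begin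
  n                      ≡⟨ sym (length-tabulate {n = n} (λ i → i)) ⟩
  length (allFin n)      ≤⟨ unique-⊆⇒length≤ (allFin⁺ n) (λ {x} _ → covered x) ⟩
  length (endpoints ps)  ≡⟨ length-endpoints ps ⟩
  2 * length ps          ∎
  where
  open ≤-Reasoning
  covered : ∀ x → x ∈ₗ endpoints ps
  covered x with cover x
  ... | p , p∈ps , x∈p = ∈-endpoints⁺ p∈ps x∈p

increasingPairs : ∀ n → List (Fin n × Fin n)
increasingPairs zero = []
increasingPairs (suc n) =
  map (λ j → zero , suc j) (allFin n) ++ map (Product.map suc suc) (increasingPairs n)

∈-increasingPairs : ∀ {n} {i j : Fin n} → i <ᶠ j → (i , j) ∈ₗ increasingPairs n
∈-increasingPairs {suc n} {zero} {suc j} _ =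
  ∈-++⁺ˡ (∈-map⁺ (λ j → zero , suc j) (∈-allFin j))
∈-increasingPairs {suc n} {suc i} {suc j} (s≤s i<j) =
  ∈-++⁺ʳ (map (λ j → zero , suc j) (allFin n))
         (∈-map⁺ (Product.map suc suc) (∈-increasingPairs i<j))

length-increasingPairs : ∀ n → 2 * length (increasingPairs n) + n ≡ n * n
length-increasingPairs zero = refl
length-increasingPairs (suc n) = begin
  2 * length (increasingPairs (suc n)) + suc n  ≡⟨ cong (λ l → 2 * l + suc n) length-step ⟩
  2 * (n + L) + suc n                           ≡⟨ regroup n L ⟩
  (2 * L + n) + (2 * n + 1)                     ≡⟨ cong (_+ (2 * n + 1)) (length-increasingPairs n) ⟩
  n * n + (2 * n + 1)                           ≡⟨ square-suc n ⟩
  suc n * suc n                                 ∎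
  where
  open ≡-Reasoning
  L : ℕ
  L = length (increasingPairs n)
  regroup : ∀ n l → 2 * (n + l) + suc n ≡ (2 * l + n) + (2 * n + 1)
  regroup = solve-∀
  square-suc : ∀ n → n * n + (2 * n + 1) ≡ suc n * suc n
  square-suc = solve-∀
  length-step : length (increasingPairs (suc n)) ≡ n + L
  length-step = begin
    length (increasingPairs (suc n))
      ≡⟨ length-++ (map (λ j → zero , suc j) (allFin n)) ⟩
    length (map (λ j → zero , suc j) (allFin n)) + length (map (Product.map suc suc) (increasingPairs n))
      ≡⟨ cong₂ _+_ (trans (length-map _ (allFin n)) (length-tabulate {n = n} (λ i → i)))
                   (length-map _ (increasingPairs n)) ⟩
    n + L ∎

odd∧n≤2*k⇒n<2*k : ∀ {n} k → n % 2 ≡ 1 → n ≤ 2 * k → n < 2 * k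
odd∧n≤2*k⇒n<2*k {n} k odd n≤2k with m≤n⇒m<n∨m≡n n≤2k
... | inj₁ n<2k = n<2k
... | inj₂ refl = contradiction (trans (sym odd) (trans (cong (_% 2) (*-comm 2 k)) (m*n%n≡0 k 2))) λ ()

t*[1+n]+n≤n*n⇒t+2≤n : ∀ {n} t → 2 ≤ n → t * suc n + n ≤ n * n → t + 2 ≤ n
t*[1+n]+n≤n*n⇒t+2≤n {suc zero} t (s≤s ()) _
t*[1+n]+n≤n*n⇒t+2≤n {suc (suc k)} t _ bound with t ≤? k
... | yes t≤k = subst (t + 2 ≤_) (+-comm k 2) (+-monoˡ-≤ 2 t≤k)
... | no t≰k = contradiction too-big (m+1+n≰m (n * n))
  where
  n : ℕ
  n = suc (suc k)
  open ≤-Reasoning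
  regroup : ∀ k → (2 + k) * (2 + k) + suc k ≡ suc k * (3 + k) + (2 + k)
  regroup = solve-∀
  too-big : n * n + suc k ≤ n * n
  too-big = begin
    n * n + suc k      ≡⟨ regroup k ⟩
    suc k * suc n + n  ≤⟨ +-monoˡ-≤ n (*-monoˡ-≤ (suc n) (≰⇒> t≰k)) ⟩
    t * suc n + n      ≤⟨ bound ⟩
    n * n              ∎

n+m∸u+2≤n⇒m+2≤u : ∀ n m u → (n + m) ∸ u + 2 ≤ n → m + 2 ≤ u
n+m∸u+2≤n⇒m+2≤u n m u bound = +-cancelʳ-≤ n (m + 2) u (begin
  m + 2 + n              ≡⟨ regroup n m ⟩
  (n + m) + 2            ≤⟨ +-monoˡ-≤ 2 (m≤n+m∸n (n + m) u) ⟩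
  u + ((n + m) ∸ u) + 2  ≡⟨ +-assoc u _ 2 ⟩
  u + ((n + m) ∸ u + 2)  ≤⟨ +-monoʳ-≤ u bound ⟩
  u + n                  ∎)
  where
  open ≤-Reasoning
  regroup : ∀ n m → m + 2 + n ≡ (n + m) + 2
  regroup = solve-∀

2n+[n+1]m≤[n+1][m+2] : ∀ n m → 2 * n + (n + 1) * m ≤ (n + 1) * (m + 2)
2n+[n+1]m≤[n+1][m+2] n m = begin
  2 * n + (n + 1) * m      ≤⟨ m≤m+n _ 2 ⟩
  2 * n + (n + 1) * m + 2  ≡⟨ expand n m ⟩
  (n + 1) * (m + 2)        ∎
  where
  open ≤-Reasoning
  expand : ∀ n m → 2 * n + (n + 1) * m + 2 ≡ (n + 1) * (m + 2)
  expand = solve-∀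

elements : ∀ {k} → Subset k → List (Fin k)
elements [] = []
elements (true ∷ p) = zero ∷ map suc (elements p)
elements (false ∷ p) = map suc (elements p)

∈-elements⁻ : ∀ {k} {p : Subset k} {x} → x ∈ₗ elements p → x ∈ p
∈-elements⁻ {p = true ∷ p} (here refl) = here
∈-elements⁻ {p = true ∷ p} (there x∈) with ∈-map⁻ suc x∈
... | _ , y∈ , refl = there (∈-elements⁻ y∈)
∈-elements⁻ {p = false ∷ p} x∈ with ∈-map⁻ suc x∈
... | _ , y∈ , refl = there (∈-elements⁻ y∈)

elements-unique : ∀ {k} (p : Subset k) → Unique (elements p)
elements-unique [] = []
elements-unique (true ∷ p) = All.tabulate zero∉ ∷ map⁺ Finₚ.suc-injective (elements-unique p)
  where
  zero∉ : ∀ {x} → x ∈ₗ map suc (elements p) → zero ≢ x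
  zero∉ x∈ with ∈-map⁻ suc x∈
  ... | _ , _ , refl = λ ()
elements-unique (false ∷ p) = map⁺ Finₚ.suc-injective (elements-unique p)

length-elements : ∀ {k} (p : Subset k) → length (elements p) ≡ ∣ p ∣
length-elements [] = refl
length-elements (true ∷ p) = cong suc (trans (length-map suc (elements p)) (length-elements p))
length-elements (false ∷ p) = trans (length-map suc (elements p)) (length-elements p)

module _ {N} {G : Graph N} where

  second : ∀ {u v} → Walk G u v → Fin N
  second (stop v) = v
  second (step {w = w} _ _) = w

  adj⇒≢ : ∀ {u v} → Adj G u v → u ≢ v
  adj⇒≢ e refl = irrefl G e

  edge-isPath : ∀ {u v} (e : Adj G u v) → IsPath {G = G} (step e (stop v))
  edge-isPath e = (adj⇒≢ e ∷ []) ∷ [] ∷ []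

  two-edges-isPath : ∀ {u w v} (e : Adj G u w) (f : Adj G w v) → u ≢ v →
    IsPath {G = G} (step e (step f (stop v)))
  two-edges-isPath e f u≢v = (adj⇒≢ e ∷ u≢v ∷ []) ∷ (adj⇒≢ f ∷ []) ∷ [] ∷ []

  edgeOn-short-walk : ∀ {u v a b} (W : Walk G u v) → len W ≤ 2 → EdgeOn a b W → b ≢ u → b ≢ v →
    second W ≡ b × Adj G u b × Adj G b v × (a ≡ u ⊎ a ≡ v)
  edgeOn-short-walk (step _ (stop _)) _ (here _ _ (inj₁ (_ , b≡v))) _ b≢v = contradiction b≡v b≢v
  edgeOn-short-walk (step _ (stop _)) _ (here _ _ (inj₂ (_ , b≡u))) b≢u _ = contradiction b≡u b≢u
  edgeOn-short-walk (step e (step f (stop _))) _ (here _ _ (inj₁ (refl , refl))) _ _ =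
    refl , e , f , inj₁ refl
  edgeOn-short-walk (step _ (step _ (stop _))) _ (here _ _ (inj₂ (_ , b≡u))) b≢u _ =
    contradiction b≡u b≢u
  edgeOn-short-walk (step _ (step _ (stop _))) _ (there _ _ (here _ _ (inj₁ (_ , b≡v)))) _ b≢v =
    contradiction b≡v b≢v
  edgeOn-short-walk (step e (step f (stop _))) _ (there _ _ (here _ _ (inj₂ (refl , refl)))) _ _ =
    refl , e , f , inj₂ refl
  edgeOn-short-walk (step _ (step _ (step _ _))) (s≤s (s≤s ())) _ _ _

module _ {n m : ℕ} where

  adj-Y⇒X : ∀ {u y : Fin (n + m)} → KAdj n m u y → n ≤ toℕ y → InX n u
  adj-Y⇒X (inj₁ (u<n , _)) _ = u<n
  adj-Y⇒X (inj₂ (_ , y<n)) n≤y = contradiction y<n (≤⇒≯ n≤y)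

  ↑ˡ-inX : (i : Fin n) → InX n (i ↑ˡ m)
  ↑ˡ-inX i = subst (_< n) (sym (toℕ-↑ˡ i m)) (toℕ<n i)

  ↑ʳ-inY : (j : Fin m) → n ≤ toℕ (n ↑ʳ j)
  ↑ʳ-inY j = subst (n ≤_) (sym (toℕ-↑ʳ n j)) (m≤m+n n (toℕ j))

  ↑ˡ-preimage : ∀ {u : Fin (n + m)} → InX n u → ∃ λ i → i ↑ˡ m ≡ u
  ↑ˡ-preimage u<n = fromℕ< u<n , toℕ-injective (trans (toℕ-↑ˡ (fromℕ< u<n) m) (toℕ-fromℕ< u<n))

  ↑ˡ-<-toℕ : ∀ {i j : Fin n} → i <ᶠ j → toℕ (i ↑ˡ m) < toℕ (j ↑ˡ m)
  ↑ˡ-<-toℕ {i} {j} = subst₂ _<_ (sym (toℕ-↑ˡ i m)) (sym (toℕ-↑ˡ j m))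

  K-path≤2 : Fin n → Fin m → ∀ {u v : Fin (n + m)} → u ≢ v →
    Σ (Walk (K n m) u v) λ W → IsPath W × len W ≤ 2
  K-path≤2 x₀ y₀ {u} {v} u≢v with toℕ u <? n | toℕ v <? n
  ... | yes u<n | yes v<n =
    let e = inj₁ (u<n , ↑ʳ-inY y₀) ; f = inj₂ (↑ʳ-inY y₀ , v<n)
    in step e (step f (stop v)) , two-edges-isPath {G = K n m} e f u≢v , ≤-refl
  ... | yes u<n | no v≮n =
    let e = inj₁ (u<n , ≮⇒≥ v≮n) in step e (stop v) , edge-isPath {G = K n m} e , s≤s z≤n
  ... | no u≮n | yes v<n =
    let e = inj₂ (≮⇒≥ u≮n , v<n) in step e (stop v) , edge-isPath {G = K n m} e , s≤s z≤n
  ... | no u≮n | no v≮n =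
    let e = inj₂ (≮⇒≥ u≮n , ↑ˡ-inX x₀) ; f = inj₁ (↑ˡ-inX x₀ , ≮⇒≥ v≮n)
    in step e (step f (stop v)) , two-edges-isPath {G = K n m} e f u≢v , ≤-refl

  K-shortest≤2 : Fin n → Fin m → ∀ {u v : Fin (n + m)} → toℕ u < toℕ v →
    (P : ShortestPath (K n m) u v) → len (proj₁ P) ≤ 2
  K-shortest≤2 x₀ y₀ u<v (_ , _ , minimal) with K-path≤2 x₀ y₀ (Finₚ.<⇒≢ u<v)
  ... | Q , isPathQ , Q≤2 = ≤-trans (minimal Q isPathQ) Q≤2

module Labelling {n m : ℕ} {U : Subset (n + m)} (x₀ : Fin n) (y₀ : Fin m)
  (seg : StrongEdgeGeodetic (K n m) U) (X⊆U : ∀ (i : Fin (n + m)) → InX n i → i ∈ U) where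

  assign : (u v : Fin (n + m)) → u ∈ U → v ∈ U → toℕ u < toℕ v → Maybe (ShortestPath (K n m) u v)
  assign = proj₁ seg

  middle : ∀ {u v} → Maybe (ShortestPath (K n m) u v) → Fin (n + m)
  middle (just (W , _)) = second W
  middle {u} nothing = u

  -- On pairs that are not increasing, and on pairs carrying no path, the label is a junk
  -- value that is never consulted.
  label : Fin n × Fin n → Fin (n + m)
  label (i , j) with i <?ᶠ j
  ... | yes i<j =
    middle (assign (i ↑ˡ m) (j ↑ˡ m) (X⊆U _ (↑ˡ-inX i)) (X⊆U _ (↑ˡ-inX j)) (↑ˡ-<-toℕ i<j))
  ... | no _ = i ↑ˡ m

  label-assigned : ∀ {i j} hu hv lt {P} → assign (i ↑ˡ m) (j ↑ˡ m) hu hv lt ≡ just P →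
    label (i , j) ≡ second (proj₁ P)
  label-assigned {i} {j} hu hv lt assigned with i <?ᶠ j
  ... | no i≮j = contradiction (subst₂ _<_ (toℕ-↑ˡ i m) (toℕ-↑ˡ j m) lt) i≮j
  ... | yes i<j
    with refl ← []=-irrelevant (X⊆U _ (↑ˡ-inX i)) hu
       | refl ← []=-irrelevant (X⊆U _ (↑ˡ-inX j)) hv
       | refl ← <-irrelevant (↑ˡ-<-toℕ i<j) lt = cong middle assigned

  ∉U⇒inY : ∀ {y} → y ∉ U → n ≤ toℕ y
  ∉U⇒inY {y} y∉U = ≮⇒≥ λ y<n → y∉U (X⊆U y y<n)

  ∉U⇒labels-cover : ∀ {y} → y ∉ U → (x : Fin n) →
    ∃ λ p → p ∈ₗ increasingPairs n × label p ≡ y × Endpoint x p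
  ∉U⇒labels-cover {y} y∉U x
    with y∈Y ← ∉U⇒inY y∉U
    with proj₂ seg (x ↑ˡ m) y (inj₁ (↑ˡ-inX x , y∈Y))
  ... | u , v , hu , hv , u<v , P , assigned , xy∈P
    with edgeOn-short-walk (proj₁ P) (K-shortest≤2 x₀ y₀ u<v P) xy∈P
           (λ { refl → y∉U hu }) (λ { refl → y∉U hv })
  ... | second≡y , u-y , y-v , x∈uv
    with ↑ˡ-preimage (adj-Y⇒X u-y y∈Y) | ↑ˡ-preimage (adj-Y⇒X (Defs.sym (K n m) y-v) y∈Y)
  ... | i , refl | j , refl =
    (i , j) , ∈-increasingPairs (subst₂ _<_ (toℕ-↑ˡ i m) (toℕ-↑ˡ j m) u<v) ,
    trans (label-assigned hu hv u<v assigned) second≡y ,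
    Sum.map (↑ˡ-injective m x i) (↑ˡ-injective m x j) x∈uv

  odd⇒∉U-fibre-large : n % 2 ≡ 1 → ∀ {y} → y ∉ U →
    ∀ zs → ContainsFibre Finₚ._≟_ label y (increasingPairs n) zs → suc n ≤ 2 * length zs
  odd⇒∉U-fibre-large odd y∉U zs fibre⊆zs =
    odd∧n≤2*k⇒n<2*k (length zs) odd (pairs-cover⇒≤2*length zs λ x →
      let p , p∈ , label≡y , x∈p = ∉U⇒labels-cover y∉U x in p , fibre⊆zs p∈ label≡y , x∈p)

  odd⇒∣∁U∣*[1+n]+n≤n*n : n % 2 ≡ 1 → ∣ ∁ U ∣ * suc n + n ≤ n * n
  odd⇒∣∁U∣*[1+n]+n≤n*n odd = begin
    ∣ ∁ U ∣ * suc n + n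
      ≡⟨ cong (λ t → t * suc n + n) (sym (length-elements (∁ U))) ⟩
    length (elements (∁ U)) * suc n + n
      ≤⟨ +-monoˡ-≤ n (fibres-length Finₚ._≟_ label {c = 2} (increasingPairs n)
                        (elements-unique (∁ U)) (odd⇒∉U-fibre-large odd ∘ ∈∁U⇒∉U)) ⟩
    2 * length (increasingPairs n) + n
      ≡⟨ length-increasingPairs n ⟩
    n * n ∎
    where
    open ≤-Reasoning
    ∈∁U⇒∉U : ∀ {y} → y ∈ₗ elements (∁ U) → y ∉ U
    ∈∁U⇒∉U = x∈∁p⇒x∉p ∘ ∈-elements⁻

lemma2p5 : (n m : ℕ) → 2 ≤ m → m ≤ n → (U : Subset (n + m)) →
    StrongEdgeGeodetic (K n m) U → n % 2 ≡ 1 →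
    (∀ (i : Fin (n + m)) → InX n i → i ∈ U) →
    2 * n + (n + 1) * m ≤ (n + 1) * ∣ U ∣
lemma2p5 n m 2≤m m≤n U seg odd X⊆U =
  ≤-trans (2n+[n+1]m≤[n+1][m+2] n m) (*-monoʳ-≤ (n + 1) (n+m∸u+2≤n⇒m+2≤u n m ∣ U ∣ missing+2≤n))
  where
  2≤n : 2 ≤ n
  2≤n = ≤-trans 2≤m m≤n
  open Labelling (fromℕ< (≤-trans (s≤s z≤n) 2≤n)) (fromℕ< (≤-trans (s≤s z≤n) 2≤m)) seg X⊆U
  missing+2≤n : (n + m) ∸ ∣ U ∣ + 2 ≤ n
  missing+2≤n = subst (λ t → t + 2 ≤ n) (∣∁p∣≡n∸∣p∣ U)
    (t*[1+n]+n≤n*n⇒t+2≤n ∣ ∁ U ∣ 2≤n (odd⇒∣∁U∣*[1+n]+n≤n*n odd))
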